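{- Let $\mathcal D\subseteq\mathcal L(A)$ be a peak-pit Condorcet domain. (a) Let $a,b,c\in A$ be distinct and let $X,Y$ be words such that $R=X\,abc\,Y$ and $T=X\,cab\,Y$ are linear orders in $\mathcal D$. Let $S=X\,acb\,Y\in\mathcal L(A)$. Then $\mathcal D\cup\{S\}$ is a peak-pit Condorcet domain. (b) Let $a,b,c,d\in A$ be distinct and let $X,Y,Z$ be words such that $R=X\,ab\,Y\,cd\,Z$ and $T=X\,ba\,Y\,dc\,Z$ are linear orders in $\mathcal D$. Let $S_1=X\,ba\,Y\,cd\,Z$ and $S_2=X\,ab\,Y\,dc\,Z$. Then $\mathcal D\cup\{S_1,S_2\}$ is a peak-pit Condorcet domain satisfying the same set of never-conditions as $\mathcal D$; in particular $\mathcal D$, $\mathcal D\cup\{S_1\}$ and $\mathcal D\cup\{S_2\}$ are peak-pit Condorcet domains satisfying the same never-conditions. (c) Let $\mathcal A$ and $\mathcal B$ be equivalent paths of alike linear orders in $\mathcal L(A)$ such that $\mathcal D\cup K(\mathcal A)$ is a peak-pit Condorcet domain. Then $\mathcal D\cup K(\mathcal B)$ is a peak-pit Condorcet domain and satisfies the same set of never-conditions as $\mathcal D\cup K(\mathcal A)$.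
   Context: $A$ is a finite set; linear orders on $A$ are written as words listing all alternatives from top to bottom, and concatenation of words is written by juxtaposition (so $X\,abc\,Y$ means $a,b,c$ appear consecutively in this order, preceded by the alternatives of $X$ and followed by those of $Y$). For distinct $p,q,r$, $x\in\{p,q,r\}$, $k\in\{1,2,3\}$, a domain satisfies the never-condition $xN_{\{p,q,r\}}k$ if none of its orders restricted to $\{p,q,r\}$ has $x$ in position $k$; a domain is a peak-pit Condorcet domain if for every triple of distinct alternatives it satisfies some such condition with $k=1$ or $k=3$. Two orders are alike if they differ by a swap of two alternatives in adjacent positions (the unordered switching pair). A path $\mathcal A=(R_1,\dots,R_k)$ connecting $R_1$ and $R_k$ has consecutive orders alike; $K(\mathcal A)=\{R_1,\dots,R_k\}$ and $S(\mathcal A)$ is its sequence of switching pairs. Two paths connecting the same $R$ and $T$ are equivalent if their sequences of switching pairs can be transformed into one another by finitely many exchanges of two consecutive switching pairs that are disjoint (share no alternative). -}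

module Defs where

open import Data.Nat using (ℕ; zero; suc; _≤ᵇ_)
open import Data.Fin using (Fin; toℕ; _≟_)
open import Data.List using (List; []; _∷_; _++_)
open import Data.List.Membership.Propositional using (_∈_)
open import Data.List.Relation.Unary.Unique.Propositional using (Unique)
open import Data.Product using (_×_; _,_; Σ; ∃; ∃-syntax)
open import Data.Sum using (_⊎_)
open import Data.Bool using (Bool; true; false; if_then_else_; _∨_)
open import Data.Empty using (⊥)
open import Relation.Nullary using (¬_; does)
open import Relation.Binary.PropositionalEquality using (_≡_)
open import Relation.Binary.Construct.Closure.ReflexiveTransitive using (Star)

-- Alternatives: A = Fin n.  A linear order on A is a word (list) listing
-- every alternative exactly once, from top to bottom.
Word : ℕ → Set
Word n = List (Fin n)

IsLinearOrder : {n : ℕ} → Word n → Set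
IsLinearOrder {n} R = Unique R × (∀ (x : Fin n) → x ∈ R)

Domain : ℕ → Set₁
Domain n = Word n → Set

IsDomain : {n : ℕ} → Domain n → Set
IsDomain D = ∀ R → D R → IsLinearOrder R

_∪₁_ : {n : ℕ} → Domain n → Word n → Domain n
(D ∪₁ S) R = D R ⊎ R ≡ S

_∪₂_,_ : {n : ℕ} → Domain n → Word n → Word n → Domain n
(D ∪₂ S₁ , S₂) R = D R ⊎ (R ≡ S₁ ⊎ R ≡ S₂)

_∪D_ : {n : ℕ} → Domain n → Domain n → Domain n
(D ∪D E) R = D R ⊎ E R

Distinct3 : {n : ℕ} → Fin n → Fin n → Fin n → Set
Distinct3 p q r = ¬ p ≡ q × ¬ q ≡ r × ¬ p ≡ r

restrict : {n : ℕ} → Fin n → Fin n → Fin n → Word n → Word n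
restrict p q r [] = []
restrict p q r (y ∷ ys) =
  if does (y ≟ p) ∨ does (y ≟ q) ∨ does (y ≟ r)
  then y ∷ restrict p q r ys
  else restrict p q r ys

AtPos : {n : ℕ} → Word n → ℕ → Fin n → Set
AtPos [] k x = ⊥
AtPos (y ∷ ys) zero x = y ≡ x
AtPos (y ∷ ys) (suc k) x = AtPos ys k x

-- Never-condition x N_{p,q,r} k, with k ∈ Fin 3 (0 = top, 2 = bottom).
-- (Only meaningful for distinct p,q,r and x ∈ {p,q,r}.)
Satisfies : {n : ℕ} → Domain n → (p q r x : Fin n) → Fin 3 → Set
Satisfies D p q r x k = ∀ R → D R → ¬ AtPos (restrict p q r R) (toℕ k) x

InTriple : {n : ℕ} → Fin n → Fin n → Fin n → Fin n → Set
InTriple p q r x = x ≡ p ⊎ x ≡ q ⊎ x ≡ r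

IsPeakPit : {n : ℕ} → Domain n → Set
IsPeakPit D =
  IsDomain D ×
  (∀ p q r → Distinct3 p q r →
    ∃[ x ] (InTriple p q r x ×
      (Satisfies D p q r x Fin.zero ⊎ Satisfies D p q r x (Fin.suc (Fin.suc Fin.zero)))))
  where import Data.Fin as Fin

SameNever : {n : ℕ} → Domain n → Domain n → Set
SameNever D E = ∀ p q r x k → Distinct3 p q r → InTriple p q r x →
  (Satisfies D p q r x k → Satisfies E p q r x k) ×
  (Satisfies E p q r x k → Satisfies D p q r x k)

data Path {n : ℕ} : Word n → Word n → Set where
  single : (R : Word n) → Path R R
  step   : (U V : Word n) (x y : Fin n) {T : Word n} →
           Path (U ++ y ∷ x ∷ V) T → Path (U ++ x ∷ y ∷ V) T

K : {n : ℕ} {R T : Word n} → Path R T → Domain n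
K (single R) W = W ≡ R
K (step U V x y P) W = W ≡ U ++ x ∷ y ∷ V ⊎ K P W

-- unordered pairs, stored canonically as (smaller, larger)
UPair : ℕ → Set
UPair n = Fin n × Fin n

upair : {n : ℕ} → Fin n → Fin n → UPair n
upair x y = if toℕ x ≤ᵇ toℕ y then (x , y) else (y , x)

Sw : {n : ℕ} {R T : Word n} → Path R T → List (UPair n)
Sw (single R) = []
Sw (step U V x y P) = upair x y ∷ Sw P

DisjointPairs : {n : ℕ} → UPair n → UPair n → Set
DisjointPairs (a , b) (c , d) = ¬ a ≡ c × ¬ a ≡ d × ¬ b ≡ c × ¬ b ≡ d

Exchange : {n : ℕ} → List (UPair n) → List (UPair n) → Set
Exchange {n} s t = Σ (List (UPair n)) λ P → Σ (List (UPair n)) λ Q →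
  Σ (UPair n) λ u → Σ (UPair n) λ v →
  DisjointPairs u v × s ≡ P ++ u ∷ v ∷ Q × t ≡ P ++ v ∷ u ∷ Q

Equivalent : {n : ℕ} {R T : Word n} → Path R T → Path R T → Set
Equivalent A B = Star Exchange (Sw A) (Sw B)

{-# OPTIONS --safe #-}
-- Everything is read off restrictions to triples {p,q,r}: a never-condition x N k of D holds in E
-- as soon as every order of E agrees, at position k of its restriction, with some order of D; in
-- particular when it has the same restriction as some order of D.
-- (a) A triple other than {a,b,c} misses a or c, and then X acb Y restricts like X cab Y, or it
-- misses b, and then X acb Y restricts like X abc Y; on {a,b,c} itself, acb has the top of abc and
-- the bottom of cab.
-- (b) No triple contains all of a, b, c, d, so on every triple one of the two swaps is invisible
-- and S₁, S₂ restrict like R or T.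
-- (c) Along a path, the restriction to a triple changes only at switching pairs inside the triple,
-- and there by the transposition of that pair. Two disjoint pairs never both lie inside a triple,
-- so equivalent paths have the same inner switching sequence and hence the same restrictions.
module Submission where

open import Defs
open import Data.Nat using (ℕ; _≤ᵇ_)
open import Data.Fin using (Fin; toℕ; _≟_)
open import Data.Fin.Permutation.Components using (transpose)
open import Data.Bool using (true; false)
open import Data.List using (List; []; _∷_; _++_; map; filter)
open import Data.List.Properties
  using (filter-++; filter-accept; filter-reject; filter-all; filter-none; map-++; map-id-local)
open import Data.List.Relation.Unary.All using (All; []; _∷_)
import Data.List.Relation.Unary.All as All
open import Data.List.Relation.Unary.All.Properties using (++⁻ʳ)
open import Data.List.Relation.Unary.AllPairs using ([]; _∷_)
open import Data.List.Relation.Unary.Any using (here; there)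
open import Data.List.Membership.Propositional using (_∈_)
import Data.List.Relation.Binary.Subset.Propositional as List
open import Data.List.Relation.Binary.Subset.Propositional.Properties using (⊆-reflexive)
open import Data.List.Relation.Unary.Unique.Propositional using (Unique)
open import Data.List.Relation.Binary.Permutation.Propositional using (_↭_; prep; swap; ↭-refl; ↭⇒↭ₛ)
open import Data.List.Relation.Binary.Permutation.Propositional.Properties using (∈-resp-↭; ++⁺ˡ)
open import Data.List.Relation.Binary.Permutation.Setoid.Properties using (Unique-resp-↭)
open import Data.Product using (_×_; _,_; proj₁; proj₂; ∃-syntax)
open import Data.Sum using (_⊎_; inj₁; inj₂)
import Data.Sum as Sum
open import Data.Empty using (⊥; ⊥-elim)
open import Function using (_∘_; id; flip)
open import Function.Bundles using (_⇔_; mk⇔; Equivalence)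
open import Relation.Nullary using (¬_; does; yes; no; ¬?)
open import Relation.Nullary.Decidable using (_⊎-dec_; _×-dec_; dec-true; dec-false)
open import Relation.Unary using (Decidable; _⊆_; _≐_)
open import Relation.Binary.PropositionalEquality
  using (_≡_; _≢_; refl; sym; trans; cong; cong₂; subst; _≗_; setoid; module ≡-Reasoning)
open import Relation.Binary.Construct.Closure.ReflexiveTransitive using (Star; ε; _◅_)

private
  variable
    n : ℕ
    A : Set
    p q r a b c d x y : Fin n
    U V W X Y Z : Word n
    D E : Domain n

module _ {P : A → Set} (P? : Decidable P) where

  filter-swap : ∀ xs {x y zs} → ¬ P x ⊎ ¬ P y → filter P? (xs ++ x ∷ y ∷ zs) ≡ filter P? (xs ++ y ∷ x ∷ zs)
  filter-swap xs {x} {y} {zs} out = begin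
    filter P? (xs ++ x ∷ y ∷ zs)             ≡⟨ filter-++ P? xs _ ⟩
    filter P? xs ++ filter P? (x ∷ y ∷ zs)   ≡⟨ cong (filter P? xs ++_) (adjacent out) ⟩
    filter P? xs ++ filter P? (y ∷ x ∷ zs)   ≡⟨ filter-++ P? xs _ ⟨
    filter P? (xs ++ y ∷ x ∷ zs)             ∎
    where
    open ≡-Reasoning
    adjacent : ∀ {x y} → ¬ P x ⊎ ¬ P y → filter P? (x ∷ y ∷ zs) ≡ filter P? (y ∷ x ∷ zs)
    adjacent {x} {y} (inj₁ ¬Px) rewrite filter-reject P? {x} {y ∷ zs} ¬Px with does (P? y)
    ... | true  = cong (y ∷_) (sym (filter-reject P? ¬Px))
    ... | false = sym (filter-reject P? ¬Px)
    adjacent (inj₂ ¬Py) = sym (adjacent (inj₁ ¬Py))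

unique-++⁻ : ∀ (xs : List A) {ys} → Unique (xs ++ ys) → All (λ x → All (x ≢_) ys) xs × Unique ys
unique-++⁻ []       u            = [] , u
unique-++⁻ (x ∷ xs) (x≢xs ∷ u) =
  let fresh , u′ = unique-++⁻ xs u in (++⁻ʳ xs x≢xs ∷ fresh) , u′

Swaps : (A → A) → A → A → Set
Swaps f x y = f x ≡ y × f y ≡ x × (∀ {z} → z ≢ x → z ≢ y → f z ≡ z)

swaps-sym : ∀ {f : A → A} {x y} → Swaps f x y → Swaps f y x
swaps-sym (fx≡y , fy≡x , fixes) = fy≡x , fx≡y , flip fixes

map-swaps : ∀ {f : A → A} {x y} (xs : List A) {ys} → Swaps f x y → Unique (xs ++ x ∷ y ∷ ys) →
            map f (xs ++ x ∷ y ∷ ys) ≡ xs ++ y ∷ x ∷ ys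
map-swaps {f = f} {x} {y} xs {ys} (fx≡y , fy≡x , fixes) u = begin
  map f (xs ++ x ∷ y ∷ ys)          ≡⟨ map-++ f xs _ ⟩
  map f xs ++ f x ∷ f y ∷ map f ys  ≡⟨ cong₂ _++_ (map-id-local fixes-xs)
                                         (cong₂ _∷_ fx≡y (cong₂ _∷_ fy≡x (map-id-local fixes-ys))) ⟩
  xs ++ y ∷ x ∷ ys                  ∎
  where
  open ≡-Reasoning
  fresh = unique-++⁻ xs u
  fixes-xs : All (λ z → f z ≡ z) xs
  fixes-xs = All.map (λ { (z≢x ∷ z≢y ∷ _) → fixes z≢x z≢y }) (proj₁ fresh)
  fixes-ys : All (λ z → f z ≡ z) ys
  fixes-ys with (_ ∷ x≢ys) ∷ y≢ys ∷ _ ← proj₂ fresh =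
    All.zipWith (λ (x≢z , y≢z) → fixes (x≢z ∘ sym) (y≢z ∘ sym)) (x≢ys , y≢ys)

swaps-preserves : ∀ {f : Fin n → Fin n} {P : Fin n → Set} → Swaps f x y → P x → P y → (P ∘ f) ≐ P
swaps-preserves {x = x} {y} {f} {P} (fx≡y , fy≡x , fixes) Px Py = to , from
  where
  either : ∀ z → (P z × P (f z)) ⊎ f z ≡ z
  either z with z ≟ x | z ≟ y
  ... | yes refl | _        = inj₁ (Px , subst P (sym fx≡y) Py)
  ... | no _     | yes refl = inj₁ (Py , subst P (sym fy≡x) Px)
  ... | no z≢x   | no z≢y   = inj₂ (fixes z≢x z≢y)
  to : P ∘ f ⊆ P
  to {z} Pfz with either z
  ... | inj₁ (Pz , _) = Pz
  ... | inj₂ fz≡z     = subst P fz≡z Pfz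
  from : P ⊆ P ∘ f
  from {z} Pz with either z
  ... | inj₁ (_ , Pfz) = Pfz
  ... | inj₂ fz≡z      = subst P (sym fz≡z) Pz

transpose-swaps : x ≢ y → Swaps (transpose x y) x y
transpose-swaps {x = x} {y} x≢y = left , right , fixes
  where
  left : transpose x y x ≡ y
  left rewrite dec-true (x ≟ x) refl = refl
  right : transpose x y y ≡ x
  right rewrite dec-false (y ≟ x) (x≢y ∘ sym) | dec-true (y ≟ y) refl = refl
  fixes : ∀ {z} → z ≢ x → z ≢ y → transpose x y z ≡ z
  fixes {z} z≢x z≢y rewrite dec-false (z ≟ x) z≢x | dec-false (z ≟ y) z≢y = refl

isLinearOrder-resp-↭ : U ↭ V → IsLinearOrder U → IsLinearOrder V
isLinearOrder-resp-↭ U↭V (unique , complete) =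
  Unique-resp-↭ (setoid _) (↭⇒↭ₛ U↭V) unique , ∈-resp-↭ U↭V ∘ complete

private
  inTriple-≢ : InTriple p q r x → x ≢ p → x ≡ q ⊎ x ≡ r
  inTriple-≢ (inj₁ x≡p) x≢p = ⊥-elim (x≢p x≡p)
  inTriple-≢ (inj₂ x∈qr) _  = x∈qr

  no-three-in-pair : {x y z q r : Fin n} → x ≡ q ⊎ x ≡ r → y ≡ q ⊎ y ≡ r → z ≡ q ⊎ z ≡ r →
                     x ≢ y → x ≢ z → y ≢ z → ⊥
  no-three-in-pair (inj₁ refl) (inj₁ refl) _           x≢y _   _   = x≢y refl
  no-three-in-pair (inj₂ refl) (inj₂ refl) _           x≢y _   _   = x≢y refl
  no-three-in-pair (inj₁ refl) (inj₂ refl) (inj₁ refl) _   x≢z _   = x≢z refl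
  no-three-in-pair (inj₁ refl) (inj₂ refl) (inj₂ refl) _   _   y≢z = y≢z refl
  no-three-in-pair (inj₂ refl) (inj₁ refl) (inj₁ refl) _   _   y≢z = y≢z refl
  no-three-in-pair (inj₂ refl) (inj₁ refl) (inj₂ refl) _   x≢z _   = x≢z refl

no-four-in-triple :
  InTriple p q r a → InTriple p q r b → InTriple p q r c → InTriple p q r d →
  a ≢ b → a ≢ c → a ≢ d → b ≢ c → b ≢ d → c ≢ d → ⊥
no-four-in-triple (inj₁ refl) b∈ c∈ d∈ a≢b a≢c a≢d b≢c b≢d c≢d =
  no-three-in-pair (inTriple-≢ b∈ (a≢b ∘ sym)) (inTriple-≢ c∈ (a≢c ∘ sym)) (inTriple-≢ d∈ (a≢d ∘ sym))
    b≢c b≢d c≢d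
no-four-in-triple (inj₂ a∈) (inj₁ refl) c∈ d∈ _ a≢c a≢d b≢c b≢d c≢d =
  no-three-in-pair a∈ (inTriple-≢ c∈ (b≢c ∘ sym)) (inTriple-≢ d∈ (b≢d ∘ sym)) a≢c a≢d c≢d
no-four-in-triple (inj₂ a∈) (inj₂ b∈) (inj₁ refl) d∈ a≢b _ a≢d _ b≢d c≢d =
  no-three-in-pair a∈ b∈ (inTriple-≢ d∈ (c≢d ∘ sym)) a≢b a≢d b≢d
no-four-in-triple (inj₂ a∈) (inj₂ b∈) (inj₂ c∈) _ a≢b a≢c _ b≢c _ _ =
  no-three-in-pair a∈ b∈ c∈ a≢b a≢c b≢c

Unordered : UPair n → Fin n → Fin n → Set
Unordered e x y = e ≡ (x , y) ⊎ e ≡ (y , x)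

upair-unordered : ∀ (x y : Fin n) → Unordered (upair x y) x y
upair-unordered x y with toℕ x ≤ᵇ toℕ y
... | true  = inj₁ refl
... | false = inj₂ refl

transposeᵤ : UPair n → Fin n → Fin n
transposeᵤ (u , v) = transpose u v

unordered-swaps : ∀ {e : UPair n} → Unordered e x y → x ≢ y → Swaps (transposeᵤ e) x y
unordered-swaps (inj₁ refl) x≢y = transpose-swaps x≢y
unordered-swaps (inj₂ refl) x≢y = swaps-sym (transpose-swaps (x≢y ∘ sym))

walk : Word n → List (UPair n) → List (Word n)
walk w []      = w ∷ []
walk w (e ∷ s) = w ∷ walk (map (transposeᵤ e) w) s

walk-head : ∀ {w : Word n} s → w ∈ walk w s
walk-head []      = here refl
walk-head (_ ∷ _) = here refl

module Restriction {n : ℕ} (p q r : Fin n) where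

  inTriple? : Decidable (InTriple p q r)
  inTriple? x = x ≟ p ⊎-dec x ≟ q ⊎-dec x ≟ r

  restrict≗filter : restrict p q r ≗ filter inTriple?
  restrict≗filter []      = refl
  restrict≗filter (y ∷ W) with does (inTriple? y)
  ... | true  = cong (y ∷_) (restrict≗filter W)
  ... | false = restrict≗filter W

  restrict-++ : ∀ U W → restrict p q r (U ++ W) ≡ restrict p q r U ++ restrict p q r W
  restrict-++ U W rewrite restrict≗filter (U ++ W) | restrict≗filter U | restrict≗filter W =
    filter-++ inTriple? U W

  restrict-++-cong : ∀ U {W W′} → restrict p q r W ≡ restrict p q r W′ →
                     restrict p q r (U ++ W) ≡ restrict p q r (U ++ W′)
  restrict-++-cong U {W} {W′} eq = begin
    restrict p q r (U ++ W)                   ≡⟨ restrict-++ U W ⟩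
    restrict p q r U ++ restrict p q r W      ≡⟨ cong (restrict p q r U ++_) eq ⟩
    restrict p q r U ++ restrict p q r W′     ≡⟨ restrict-++ U W′ ⟨
    restrict p q r (U ++ W′)                  ∎
    where open ≡-Reasoning

  restrict-swap : ∀ U {x y V} → ¬ InTriple p q r x ⊎ ¬ InTriple p q r y →
                  restrict p q r (U ++ x ∷ y ∷ V) ≡ restrict p q r (U ++ y ∷ x ∷ V)
  restrict-swap U {x} {y} {V} out
    rewrite restrict≗filter (U ++ x ∷ y ∷ V) | restrict≗filter (U ++ y ∷ x ∷ V) =
    filter-swap inTriple? U out

  restrict-middle : ∀ {U} W {V} → All (¬_ ∘ InTriple p q r) U → All (InTriple p q r) W →
                    restrict p q r (U ++ W ++ V) ≡ W ++ restrict p q r V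
  restrict-middle {U} W {V} U-out W-in
    rewrite restrict≗filter (U ++ W ++ V) | restrict≗filter V
          | filter-++ inTriple? U (W ++ V) | filter-++ inTriple? W V
          | filter-none inTriple? U-out | filter-all inTriple? W-in = refl

  restrict-map : ∀ {f} → (InTriple p q r ∘ f) ≐ InTriple p q r →
                 ∀ W → restrict p q r (map f W) ≡ map f (restrict p q r W)
  restrict-map {f} (to , from) W rewrite restrict≗filter (map f W) | restrict≗filter W = go W
    where
    go : ∀ W → filter inTriple? (map f W) ≡ map f (filter inTriple? W)
    go []      = refl
    go (z ∷ W) with inTriple? z
    ... | yes z∈ = begin
      filter inTriple? (f z ∷ map f W)  ≡⟨ filter-accept inTriple? (from z∈) ⟩
      f z ∷ filter inTriple? (map f W)  ≡⟨ cong (f z ∷_) (go W) ⟩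
      f z ∷ map f (filter inTriple? W)  ≡⟨ cong (map f) (filter-accept inTriple? z∈) ⟨
      map f (filter inTriple? (z ∷ W))  ∎
      where open ≡-Reasoning
    ... | no z∉ = begin
      filter inTriple? (f z ∷ map f W)  ≡⟨ filter-reject inTriple? (z∉ ∘ to) ⟩
      filter inTriple? (map f W)        ≡⟨ go W ⟩
      map f (filter inTriple? W)        ≡⟨ cong (map f) (filter-reject inTriple? z∉) ⟨
      map f (filter inTriple? (z ∷ W))  ∎
      where open ≡-Reasoning

  restrict-swap-inside : ∀ {f} U {x y V} → Swaps f x y → InTriple p q r x → InTriple p q r y →
                       Unique (U ++ x ∷ y ∷ V) →
                       map f (restrict p q r (U ++ x ∷ y ∷ V)) ≡ restrict p q r (U ++ y ∷ x ∷ V)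
  restrict-swap-inside {f} U {x} {y} {V} swaps x∈ y∈ u = begin
    map f (restrict p q r (U ++ x ∷ y ∷ V))  ≡⟨ restrict-map (swaps-preserves swaps x∈ y∈) (U ++ x ∷ y ∷ V) ⟨
    restrict p q r (map f (U ++ x ∷ y ∷ V))  ≡⟨ cong (restrict p q r) (map-swaps U swaps u) ⟩
    restrict p q r (U ++ y ∷ x ∷ V)          ∎
    where open ≡-Reasoning

  -- u ≢ v matters: otherwise a degenerate pair (u , u) could be exchanged with a disjoint inner pair.
  InnerPair : UPair n → Set
  InnerPair (u , v) = InTriple p q r u × InTriple p q r v × u ≢ v

  innerPair? : Decidable InnerPair
  innerPair? (u , v) = inTriple? u ×-dec inTriple? v ×-dec ¬? (u ≟ v)

  innerPairs : List (UPair n) → List (UPair n)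
  innerPairs = filter innerPair?

  innerPair-sym : ∀ {u v} → InnerPair (u , v) → InnerPair (v , u)
  innerPair-sym (u∈ , v∈ , u≢v) = v∈ , u∈ , u≢v ∘ sym

  innerPair-unordered : ∀ {e} → Unordered e x y → InnerPair e ⇔ InnerPair (x , y)
  innerPair-unordered (inj₁ refl) = mk⇔ id id
  innerPair-unordered (inj₂ refl) = mk⇔ innerPair-sym innerPair-sym

  innerPairs-exchange : ∀ {s t} → Exchange s t → innerPairs s ≡ innerPairs t
  innerPairs-exchange (P , _ , (u₁ , u₂) , (v₁ , v₂) , (u₁≢v₁ , u₁≢v₂ , u₂≢v₁ , u₂≢v₂) , refl , refl) =
    filter-swap innerPair? P not-both
    where
    not-both : ¬ InnerPair (u₁ , u₂) ⊎ ¬ InnerPair (v₁ , v₂)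
    not-both with innerPair? (u₁ , u₂) | innerPair? (v₁ , v₂)
    ... | yes (u₁∈ , u₂∈ , u₁≢u₂) | yes (v₁∈ , v₂∈ , v₁≢v₂) =
      ⊥-elim (no-four-in-triple u₁∈ u₂∈ v₁∈ v₂∈ u₁≢u₂ u₁≢v₁ u₁≢v₂ u₂≢v₁ u₂≢v₂ v₁≢v₂)
    ... | no outer | _        = inj₁ outer
    ... | yes _    | no outer = inj₂ outer

  innerPairs-equivalent : ∀ {s t} → Star Exchange s t → innerPairs s ≡ innerPairs t
  innerPairs-equivalent ε        = refl
  innerPairs-equivalent (e ◅ es) = trans (innerPairs-exchange e) (innerPairs-equivalent es)

  restrict-switch-inner : ∀ U {x y V e} → Unordered e x y → Unique (U ++ x ∷ y ∷ V) → InnerPair e →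
                          map (transposeᵤ e) (restrict p q r (U ++ x ∷ y ∷ V)) ≡ restrict p q r (U ++ y ∷ x ∷ V)
  restrict-switch-inner U e≈xy u inner with Equivalence.to (innerPair-unordered e≈xy) inner
  ... | x∈ , y∈ , x≢y = restrict-swap-inside U (unordered-swaps e≈xy x≢y) x∈ y∈ u

  restrict-switch-outer : ∀ U {x y V e} → Unordered e x y → ¬ InnerPair e →
                          restrict p q r (U ++ x ∷ y ∷ V) ≡ restrict p q r (U ++ y ∷ x ∷ V)
  restrict-switch-outer U {x} {y} e≈xy outer with x ≟ y | inTriple? x | inTriple? y
  ... | yes refl | _      | _      = refl
  ... | no x≢y   | yes x∈ | yes y∈ = ⊥-elim (outer (Equivalence.from (innerPair-unordered e≈xy) (x∈ , y∈ , x≢y)))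
  ... | no _     | no x∉  | _      = restrict-swap U (inj₁ x∉)
  ... | no _     | yes _  | no y∉  = restrict-swap U (inj₂ y∉)

  walk-step : ∀ {e s} {w w′ : Word n} →
              (InnerPair e → map (transposeᵤ e) w ≡ w′) → (¬ InnerPair e → w ≡ w′) →
              walk w (innerPairs (e ∷ s)) List.⊆ w ∷ walk w′ (innerPairs s) ×
              w ∷ walk w′ (innerPairs s) List.⊆ walk w (innerPairs (e ∷ s))
  walk-step {e} {s} {w} inner-step outer-step with innerPair? e
  ... | yes inner = ⊆-reflexive unfold , ⊆-reflexive (sym unfold)
    where
    unfold : walk w (innerPairs (e ∷ s)) ≡ w ∷ walk _ (innerPairs s)
    unfold = trans (cong (walk w) (filter-accept innerPair? inner))
                   (cong (λ v → w ∷ walk v (innerPairs s)) (inner-step inner))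
  ... | no outer rewrite filter-reject innerPair? {xs = s} outer | outer-step outer =
    there , λ { (here refl) → walk-head (innerPairs s) ; (there v∈) → v∈ }

  restrict-∈-walk : ∀ {R T W} (𝒫 : Path R T) → IsDomain (K 𝒫) → K 𝒫 W →
                    restrict p q r W ∈ walk (restrict p q r R) (innerPairs (Sw 𝒫))
  restrict-∈-walk (single R)       _   refl        = here refl
  restrict-∈-walk (step U V x y 𝒫) _   (inj₁ refl) = walk-head _
  restrict-∈-walk (step U V x y 𝒫) lin (inj₂ W∈𝒫) =
    proj₂ (walk-step (restrict-switch-inner U xy (proj₁ (lin _ (inj₁ refl)))) (restrict-switch-outer U xy))
      (there (restrict-∈-walk 𝒫 (λ W → lin W ∘ inj₂) W∈𝒫))
    where xy = upair-unordered x y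

  ∈-walk-restrict : ∀ {R T w} (𝒫 : Path R T) → IsDomain (K 𝒫) →
                    w ∈ walk (restrict p q r R) (innerPairs (Sw 𝒫)) → ∃[ W ] (K 𝒫 W × w ≡ restrict p q r W)
  ∈-walk-restrict (single R) _ (here w≡R) = R , refl , w≡R
  ∈-walk-restrict (step U V x y 𝒫) lin w∈
    with proj₁ (walk-step (restrict-switch-inner U (upair-unordered x y) (proj₁ (lin _ (inj₁ refl))))
                          (restrict-switch-outer U (upair-unordered x y))) w∈
  ... | here w≡R  = _ , inj₁ refl , w≡R
  ... | there w∈′ =
    let W , W∈𝒫 , w≡W = ∈-walk-restrict 𝒫 (λ W → lin W ∘ inj₂) w∈′ in W , inj₂ W∈𝒫 , w≡W

open Restriction using (inTriple?; restrict-++-cong; restrict-swap; restrict-middle;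
                   innerPairs; innerPairs-equivalent; restrict-∈-walk; ∈-walk-restrict)

Covers : Domain n → Domain n → Fin n → Fin n → Fin n → ℕ → Set
Covers D E p q r k = ∀ W → E W →
  ∃[ W′ ] (D W′ × (∀ {x} → AtPos (restrict p q r W) k x → AtPos (restrict p q r W′) k x))

Lookalikes : Domain n → Domain n → Fin n → Fin n → Fin n → Set
Lookalikes D E p q r = ∀ W → E W → ∃[ W′ ] (D W′ × restrict p q r W ≡ restrict p q r W′)

covers-satisfies : ∀ {k} → Covers D E p q r (toℕ k) → Satisfies D p q r x k → Satisfies E p q r x k
covers-satisfies cover sat W W∈E x-at-k =
  let W′ , W′∈D , agree = cover W W∈E in sat W′ W′∈D (agree x-at-k)

covers-∪ : ∀ {k} → Covers D E p q r k → Covers D (D ∪D E) p q r k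
covers-∪ cover W (inj₁ W∈D) = W , W∈D , id
covers-∪ cover W (inj₂ W∈E) = cover W W∈E

lookalikes⇒covers : Lookalikes D E p q r → ∀ k → Covers D E p q r k
lookalikes⇒covers look k W W∈E =
  let W′ , W′∈D , same = look W W∈E in W′ , W′∈D , subst (λ w → AtPos w k _) same

lookalike⇒covers : ∀ {W′} → D W′ → restrict p q r W ≡ restrict p q r W′ → ∀ k → Covers D (_≡ W) p q r k
lookalike⇒covers W′∈D same = lookalikes⇒covers λ { _ refl → _ , W′∈D , same }

lookalikes-∪ : Lookalikes D E p q r → Lookalikes D (D ∪D E) p q r
lookalikes-∪ look W (inj₁ W∈D) = W , W∈D , refl
lookalikes-∪ look W (inj₂ W∈E) = look W W∈E

lookalikes-∪-cong : ∀ {F} → Lookalikes D E p q r → Lookalikes (F ∪D D) (F ∪D E) p q r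
lookalikes-∪-cong look W (inj₁ W∈F) = W , inj₁ W∈F , refl
lookalikes-∪-cong look W (inj₂ W∈E) = let W′ , W′∈D , same = look W W∈E in W′ , inj₂ W′∈D , same

⊆⇒lookalikes : E ⊆ D → Lookalikes D E p q r
⊆⇒lookalikes E⊆D W W∈E = W , E⊆D W∈E , refl

isDomain-≡ : IsLinearOrder W → IsDomain (_≡ W)
isDomain-≡ W-lin _ refl = W-lin

isDomain-∪ : IsDomain D → IsDomain E → IsDomain (D ∪D E)
isDomain-∪ D-lin E-lin W (inj₁ W∈D) = D-lin W W∈D
isDomain-∪ D-lin E-lin W (inj₂ W∈E) = E-lin W W∈E

isPeakPit-covered : IsPeakPit D → IsDomain E →
                    (∀ p q r → Distinct3 p q r → Covers D E p q r 0 × Covers D E p q r 2) → IsPeakPit E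
isPeakPit-covered (_ , never) E-lin cover = E-lin , λ p q r pqr →
  let x , x∈ , sat = never p q r pqr ; top , bottom = cover p q r pqr
  in x , x∈ , Sum.map (covers-satisfies top) (covers-satisfies bottom) sat

isPeakPit-lookalikes : IsPeakPit D → IsDomain E →
                       (∀ p q r → Distinct3 p q r → Lookalikes D E p q r) → IsPeakPit E
isPeakPit-lookalikes D-pp E-lin look = isPeakPit-covered D-pp E-lin λ p q r pqr →
  lookalikes⇒covers (look p q r pqr) 0 , lookalikes⇒covers (look p q r pqr) 2

sameNever-lookalikes : (∀ p q r → Distinct3 p q r → Lookalikes D E p q r) →
                       (∀ p q r → Distinct3 p q r → Lookalikes E D p q r) → SameNever D E
sameNever-lookalikes D←E E←D p q r x k pqr _ =
  covers-satisfies (lookalikes⇒covers (D←E p q r pqr) (toℕ k)) ,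
  covers-satisfies (lookalikes⇒covers (E←D p q r pqr) (toℕ k))

∪-lookalikes : IsPeakPit D → IsDomain E → (∀ p q r → Distinct3 p q r → Lookalikes D E p q r) →
               IsPeakPit (D ∪D E) × SameNever D (D ∪D E)
∪-lookalikes {D = D} {E = E} D-pp E-lin look =
  isPeakPit-lookalikes D-pp (isDomain-∪ (proj₁ D-pp) E-lin) D←D∪E ,
  sameNever-lookalikes D←D∪E (λ _ _ _ _ → ⊆⇒lookalikes inj₁)
  where
  D←D∪E : ∀ p q r → Distinct3 p q r → Lookalikes D (D ∪D E) p q r
  D←D∪E p q r pqr = lookalikes-∪ (look p q r pqr)

private
  top-bottom : {P : ℕ → Set} → (∀ k → P k) → P 0 × P 2
  top-bottom P-all = P-all 0 , P-all 2

acb-covers : D (X ++ a ∷ b ∷ c ∷ Y) → D (X ++ c ∷ a ∷ b ∷ Y) → Distinct3 a b c →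
             Unique (X ++ a ∷ c ∷ b ∷ Y) → ∀ p q r →
             Covers D (_≡ X ++ a ∷ c ∷ b ∷ Y) p q r 0 × Covers D (_≡ X ++ a ∷ c ∷ b ∷ Y) p q r 2
acb-covers {D = D} {X} {a} {b} {c} {Y} R∈D T∈D (a≢b , b≢c , a≢c) u p q r
  with inTriple? p q r a | inTriple? p q r b | inTriple? p q r c
... | no a∉  | _      | _      = top-bottom (lookalike⇒covers T∈D (restrict-swap p q r X (inj₁ a∉)))
... | yes _  | _      | no c∉  = top-bottom (lookalike⇒covers T∈D (restrict-swap p q r X (inj₂ c∉)))
... | yes _  | no b∉  | yes _  =
  top-bottom (lookalike⇒covers R∈D (restrict-++-cong p q r X (restrict-swap p q r (a ∷ []) {c} {b} {Y} (inj₂ b∉))))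
... | yes a∈ | yes b∈ | yes c∈ = top , bottom
  where
  X-out : All (¬_ ∘ InTriple p q r) X
  X-out = All.map (λ { (z≢a ∷ z≢c ∷ z≢b ∷ _) z∈ → no-four-in-triple z∈ a∈ b∈ c∈ z≢a z≢b z≢c a≢b a≢c b≢c })
                  (proj₁ (unique-++⁻ X u))
  top : Covers D (_≡ X ++ a ∷ c ∷ b ∷ Y) p q r 0
  top _ refl = _ , R∈D , agree
    where
    agree : ∀ {x} → AtPos (restrict p q r (X ++ a ∷ c ∷ b ∷ Y)) 0 x → AtPos (restrict p q r (X ++ a ∷ b ∷ c ∷ Y)) 0 x
    agree rewrite restrict-middle p q r (a ∷ c ∷ b ∷ []) {Y} X-out (a∈ ∷ c∈ ∷ b∈ ∷ [])
                | restrict-middle p q r (a ∷ b ∷ c ∷ []) {Y} X-out (a∈ ∷ b∈ ∷ c∈ ∷ []) = id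
  bottom : Covers D (_≡ X ++ a ∷ c ∷ b ∷ Y) p q r 2
  bottom _ refl = _ , T∈D , agree
    where
    agree : ∀ {x} → AtPos (restrict p q r (X ++ a ∷ c ∷ b ∷ Y)) 2 x → AtPos (restrict p q r (X ++ c ∷ a ∷ b ∷ Y)) 2 x
    agree rewrite restrict-middle p q r (a ∷ c ∷ b ∷ []) {Y} X-out (a∈ ∷ c∈ ∷ b∈ ∷ [])
                | restrict-middle p q r (c ∷ a ∷ b ∷ []) {Y} X-out (c∈ ∷ a∈ ∷ b∈ ∷ []) = id

isPeakPit-∪-acb : IsPeakPit D → Distinct3 a b c → D (X ++ a ∷ b ∷ c ∷ Y) → D (X ++ c ∷ a ∷ b ∷ Y) →
                  IsLinearOrder (X ++ a ∷ c ∷ b ∷ Y) → IsPeakPit (D ∪₁ (X ++ a ∷ c ∷ b ∷ Y))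
isPeakPit-∪-acb D-pp abc R∈D T∈D S-lin =
  isPeakPit-covered D-pp (isDomain-∪ (proj₁ D-pp) (isDomain-≡ S-lin)) λ p q r _ →
    let top , bottom = acb-covers R∈D T∈D abc (proj₁ S-lin) p q r in covers-∪ top , covers-∪ bottom

one-pair-outside : a ≢ b → a ≢ c → a ≢ d → b ≢ c → b ≢ d → c ≢ d → ∀ p q r →
  (¬ InTriple p q r a ⊎ ¬ InTriple p q r b) ⊎ (¬ InTriple p q r c ⊎ ¬ InTriple p q r d)
one-pair-outside {a = a} {b} {c} {d} a≢b a≢c a≢d b≢c b≢d c≢d p q r
  with inTriple? p q r a | inTriple? p q r b | inTriple? p q r c | inTriple? p q r d
... | no a∉  | _      | _      | _      = inj₁ (inj₁ a∉)
... | yes _  | no b∉  | _      | _      = inj₁ (inj₂ b∉)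
... | yes _  | yes _  | no c∉  | _      = inj₂ (inj₁ c∉)
... | yes _  | yes _  | yes _  | no d∉  = inj₂ (inj₂ d∉)
... | yes a∈ | yes b∈ | yes c∈ | yes d∈ = ⊥-elim (no-four-in-triple a∈ b∈ c∈ d∈ a≢b a≢c a≢d b≢c b≢d c≢d)

half-swaps-lookalikes :
  D (X ++ a ∷ b ∷ Y ++ c ∷ d ∷ Z) → D (X ++ b ∷ a ∷ Y ++ d ∷ c ∷ Z) →
  a ≢ b → a ≢ c → a ≢ d → b ≢ c → b ≢ d → c ≢ d → ∀ p q r →
  Lookalikes D (λ W → W ≡ X ++ b ∷ a ∷ Y ++ c ∷ d ∷ Z ⊎ W ≡ X ++ a ∷ b ∷ Y ++ d ∷ c ∷ Z) p q r
half-swaps-lookalikes {X = X} {a} {b} {Y} {c} {d} R∈D T∈D a≢b a≢c a≢d b≢c b≢d c≢d p q r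
  with one-pair-outside a≢b a≢c a≢d b≢c b≢d c≢d p q r
... | inj₁ ab-out = λ
  { _ (inj₁ refl) → _ , R∈D , restrict-swap p q r X (Sum.swap ab-out)
  ; _ (inj₂ refl) → _ , T∈D , restrict-swap p q r X ab-out }
... | inj₂ cd-out = λ
  { _ (inj₁ refl) → _ , T∈D , restrict-++-cong p q r X (restrict-swap p q r (b ∷ a ∷ Y) cd-out)
  ; _ (inj₂ refl) → _ , R∈D , restrict-++-cong p q r X (restrict-swap p q r (a ∷ b ∷ Y) (Sum.swap cd-out)) }

∪-half-swaps :
  IsPeakPit D → D (X ++ a ∷ b ∷ Y ++ c ∷ d ∷ Z) → D (X ++ b ∷ a ∷ Y ++ d ∷ c ∷ Z) →
  a ≢ b → a ≢ c → a ≢ d → b ≢ c → b ≢ d → c ≢ d →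
  E ⊆ (λ W → W ≡ X ++ b ∷ a ∷ Y ++ c ∷ d ∷ Z ⊎ W ≡ X ++ a ∷ b ∷ Y ++ d ∷ c ∷ Z) →
  IsPeakPit (D ∪D E) × SameNever D (D ∪D E)
∪-half-swaps {X = X} {a} {b} {Y} {c} {d} {E = E} D-pp R∈D T∈D a≢b a≢c a≢d b≢c b≢d c≢d E⊆S₁S₂ =
  ∪-lookalikes D-pp E-lin λ p q r _ W → half-swaps-lookalikes R∈D T∈D a≢b a≢c a≢d b≢c b≢d c≢d p q r W ∘ E⊆S₁S₂
  where
  R-lin = proj₁ D-pp _ R∈D
  E-lin : IsDomain E
  E-lin W W∈E with E⊆S₁S₂ W∈E
  ... | inj₁ refl = isLinearOrder-resp-↭ (++⁺ˡ X (swap a b ↭-refl)) R-lin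
  ... | inj₂ refl = isLinearOrder-resp-↭ (++⁺ˡ X (prep a (prep b (++⁺ˡ Y (swap c d ↭-refl))))) R-lin

paths-lookalikes : ∀ {R T} {𝒜 ℬ : Path R T} → IsDomain (K 𝒜) → IsDomain (K ℬ) →
                   innerPairs p q r (Sw 𝒜) ≡ innerPairs p q r (Sw ℬ) → Lookalikes (K 𝒜) (K ℬ) p q r
paths-lookalikes {p = p} {q} {r} {R = R} {𝒜 = 𝒜} {ℬ} 𝒜-lin ℬ-lin same W W∈ℬ =
  ∈-walk-restrict p q r 𝒜 𝒜-lin
    (subst (λ s → restrict p q r W ∈ walk (restrict p q r R) s) (sym same) (restrict-∈-walk p q r ℬ ℬ-lin W∈ℬ))

∪-equivalent-paths : ∀ {R T} {𝒜 ℬ : Path R T} → IsDomain D → IsDomain (K 𝒜) → IsDomain (K ℬ) →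
                     Equivalent 𝒜 ℬ → IsPeakPit (D ∪D K 𝒜) →
                     IsPeakPit (D ∪D K ℬ) × SameNever (D ∪D K 𝒜) (D ∪D K ℬ)
∪-equivalent-paths {D = D} {𝒜 = 𝒜} {ℬ} D-lin 𝒜-lin ℬ-lin 𝒜≈ℬ D∪𝒜-pp =
  isPeakPit-lookalikes D∪𝒜-pp (isDomain-∪ D-lin ℬ-lin) 𝒜←ℬ , sameNever-lookalikes 𝒜←ℬ ℬ←𝒜
  where
  𝒜←ℬ : ∀ p q r → Distinct3 p q r → Lookalikes (D ∪D K 𝒜) (D ∪D K ℬ) p q r
  𝒜←ℬ p q r _ = lookalikes-∪-cong (paths-lookalikes 𝒜-lin ℬ-lin (innerPairs-equivalent p q r 𝒜≈ℬ))
  ℬ←𝒜 : ∀ p q r → Distinct3 p q r → Lookalikes (D ∪D K ℬ) (D ∪D K 𝒜) p q r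
  ℬ←𝒜 p q r _ = lookalikes-∪-cong (paths-lookalikes ℬ-lin 𝒜-lin (sym (innerPairs-equivalent p q r 𝒜≈ℬ)))

lemma12 :
  (∀ (n : ℕ) (D : Domain n) → IsPeakPit D →
    ∀ (a b c : Fin n) (X Y : Word n) → Distinct3 a b c →
    D (X ++ a ∷ b ∷ c ∷ Y) → D (X ++ c ∷ a ∷ b ∷ Y) →
    IsLinearOrder (X ++ a ∷ c ∷ b ∷ Y) →
    IsPeakPit (D ∪₁ (X ++ a ∷ c ∷ b ∷ Y)))
  ×
  (∀ (n : ℕ) (D : Domain n) → IsPeakPit D →
    ∀ (a b c d : Fin n) (X Y Z : Word n) →
    Distinct3 a b c → Distinct3 a b d → Distinct3 a c d → Distinct3 b c d →
    D (X ++ a ∷ b ∷ Y ++ c ∷ d ∷ Z) → D (X ++ b ∷ a ∷ Y ++ d ∷ c ∷ Z) →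
    (IsPeakPit (D ∪₂ (X ++ b ∷ a ∷ Y ++ c ∷ d ∷ Z) , (X ++ a ∷ b ∷ Y ++ d ∷ c ∷ Z))
      × SameNever D (D ∪₂ (X ++ b ∷ a ∷ Y ++ c ∷ d ∷ Z) , (X ++ a ∷ b ∷ Y ++ d ∷ c ∷ Z)))
    × (IsPeakPit (D ∪₁ (X ++ b ∷ a ∷ Y ++ c ∷ d ∷ Z))
      × SameNever D (D ∪₁ (X ++ b ∷ a ∷ Y ++ c ∷ d ∷ Z)))
    × (IsPeakPit (D ∪₁ (X ++ a ∷ b ∷ Y ++ d ∷ c ∷ Z))
      × SameNever D (D ∪₁ (X ++ a ∷ b ∷ Y ++ d ∷ c ∷ Z))))
  ×
  (∀ (n : ℕ) (D : Domain n) → IsPeakPit D →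
    ∀ (R T : Word n) (𝒜 ℬ : Path R T) →
    IsDomain (K 𝒜) → IsDomain (K ℬ) → Equivalent 𝒜 ℬ →
    IsPeakPit (D ∪D K 𝒜) →
    IsPeakPit (D ∪D K ℬ) × SameNever (D ∪D K 𝒜) (D ∪D K ℬ))
lemma12 =
  (λ _ _ D-pp _ _ _ _ _ → isPeakPit-∪-acb D-pp) ,
  (λ { _ _ D-pp _ _ _ _ _ _ _ (a≢b , b≢c , a≢c) (_ , b≢d , a≢d) (_ , c≢d , _) _ R∈D T∈D →
       let half-swaps = λ {E} → ∪-half-swaps {E = E} D-pp R∈D T∈D a≢b a≢c a≢d b≢c b≢d c≢d
       in half-swaps id , half-swaps inj₁ , half-swaps inj₂ }) ,
  (λ _ _ D-pp _ _ _ _ → ∪-equivalent-paths (proj₁ D-pp))
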